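{- Let $G$ be a maximal $3$-$\gamma_{c}$-vertex critical graph of order $n$ with clique number $\omega$. Then $\omega \leq n-3$, and equality holds if and only if $G$ is the cycle $C_{5}$.
   Context: All graphs are finite, simple and connected. A connected dominating set of $G$ is a set $D \subseteq V(G)$ such that every vertex of $G$ is in $D$ or adjacent to a vertex of $D$, and $G[D]$ is connected; $\gamma_{c}(G)$ is the minimum size of such a set. $G$ is $k$-$\gamma_{c}$-edge critical if $\gamma_{c}(G)=k$ and $\gamma_{c}(G+uv)<k$ for every pair of non-adjacent vertices $u,v$. A $2$-connected graph $G$ is $k$-$\gamma_{c}$-vertex critical if $\gamma_{c}(G)=k$ and $\gamma_{c}(G-v)<k$ for every $v \in V(G)$. $G$ is maximal $k$-$\gamma_{c}$-vertex critical if it is both $k$-$\gamma_{c}$-edge critical and $k$-$\gamma_{c}$-vertex critical. -}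

module Defs where

open import Data.Nat using (ℕ; zero; suc; pred; _<_; _≤_; _%_; _+_; _∸_)
open import Data.Bool using (Bool; true; false; _∨_; _∧_; T)
open import Data.Fin using (Fin; toℕ; punchIn; _≟_)
open import Data.Fin.Subset using (Subset; _∈_; ∣_∣) renaming (⊤ to Full)
open import Data.Product using (Σ; ∃; _×_; _,_)
open import Data.Sum using (_⊎_)
open import Relation.Nullary using (¬_)
open import Relation.Nullary.Decidable using (⌊_⌋)
open import Relation.Binary.PropositionalEquality using (_≡_; _≢_)
open import Function.Bundles using (_↔_; Inverse; _⇔_)

Graph : ℕ → Set
Graph n = Fin n → Fin n → Bool

Adj : ∀ {n} → Graph n → Fin n → Fin n → Set
Adj G i j = T (G i j)

Simple : ∀ {n} → Graph n → Set
Simple G = (∀ i j → G i j ≡ G j i) × (∀ i → G i i ≡ false)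

data WalkIn {n} (G : Graph n) (D : Subset n) : Fin n → Fin n → Set where
  here : ∀ {u} → u ∈ D → WalkIn G D u u
  step : ∀ {u w v} → u ∈ D → Adj G u w → WalkIn G D w v → WalkIn G D u v

InducedConnected : ∀ {n} → Graph n → Subset n → Set
InducedConnected G D = ∀ u v → u ∈ D → v ∈ D → WalkIn G D u v

Connected : ∀ {n} → Graph n → Set
Connected G = InducedConnected G Full

Dominating : ∀ {n} → Graph n → Subset n → Set
Dominating {n} G D = ∀ (v : Fin n) → v ∈ D ⊎ (∃ λ u → u ∈ D × Adj G u v)

IsCDS : ∀ {n} → Graph n → Subset n → Set
IsCDS G D = Dominating G D × InducedConnected G D

IsGammaC : ∀ {n} → Graph n → ℕ → Set
IsGammaC {n} G k =
  (Σ (Subset n) λ D → IsCDS G D × ∣ D ∣ ≡ k) ×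
  (∀ (D : Subset n) → IsCDS G D → k ≤ ∣ D ∣)

addEdge : ∀ {n} → Graph n → Fin n → Fin n → Graph n
addEdge G u v i j = G i j ∨ ((⌊ i ≟ u ⌋ ∧ ⌊ j ≟ v ⌋) ∨ (⌊ i ≟ v ⌋ ∧ ⌊ j ≟ u ⌋))

-- G - v  (vertices of G - v are relabelled via punchIn v)
removeVertex : ∀ {n} → Graph n → Fin n → Graph (pred n)
removeVertex {suc m} G v i j = G (punchIn v i) (punchIn v j)

TwoConnected : ∀ {n} → Graph n → Set
TwoConnected {n} G = 3 ≤ n × Connected G × (∀ v → Connected (removeVertex G v))

EdgeCritical : ℕ → ∀ {n} → Graph n → Set
EdgeCritical k G = IsGammaC G k ×
  (∀ u v → u ≢ v → ¬ Adj G u v → ∃ λ k' → k' < k × IsGammaC (addEdge G u v) k')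

VertexCritical : ℕ → ∀ {n} → Graph n → Set
VertexCritical k G = TwoConnected G × IsGammaC G k ×
  (∀ v → ∃ λ k' → k' < k × IsGammaC (removeVertex G v) k')

MaximalVertexCritical : ℕ → ∀ {n} → Graph n → Set
MaximalVertexCritical k G = EdgeCritical k G × VertexCritical k G

IsClique : ∀ {n} → Graph n → Subset n → Set
IsClique G K = ∀ i j → i ∈ K → j ∈ K → i ≢ j → Adj G i j

IsCliqueNumber : ∀ {n} → Graph n → ℕ → Set
IsCliqueNumber {n} G w =
  (Σ (Subset n) λ K → IsClique G K × ∣ K ∣ ≡ w) ×
  (∀ (K : Subset n) → IsClique G K → ∣ K ∣ ≤ w)

C5 : Graph 5
C5 i j = ⌊ Data.Nat._≟_ ((toℕ i + 1) % 5) (toℕ j) ⌋ ∨ ⌊ Data.Nat._≟_ ((toℕ j + 1) % 5) (toℕ i) ⌋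

Isomorphic : ∀ {n m} → Graph n → Graph m → Set
Isomorphic {n} {m} G H = Σ (Fin n ↔ Fin m) λ f →
  ∀ i j → G i j ≡ H (Inverse.to f i) (Inverse.to f j)

module Submission where

-- Write N[p] for the closed neighbourhood of p and call p, q "near" when
-- q ∈ N[p].  For a simple graph G with γc(G) = 3 whose vertex-deleted subgraphs all
-- have γc ≤ 2, the whole argument runs on pair domination:
--   (1) no near pair {p, q} dominates G (it would be a connected dominating set of
--       size ≤ 2), while
--   (2) for every vertex v some near pair dominates exactly G - v (a connected
--       dominating set of G - v of size ≤ 2 is such a pair, lifted along punchIn).
-- Given a clique K with two vertices a, b, the near pair {u, w} missing a lies outside
-- K, w.l.o.g. u ~ b, and a vertex t missed by the near pair {b, u} is a third vertex
-- outside K (w ~ t).  Hence |K| ≤ n - 3 for a maximum clique, i.e. ω ≤ n - 3.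
-- If equality holds, the outside of K is exactly {u, w, t}; then (1) forces w to have
-- no neighbour in K, u to see K - a and t to miss K - a.  Redoing the construction
-- with a and b exchanged shows t ~ a and K = {a, b}, so a b u w t is an induced
-- 5-cycle spanning G, and G ≅ C5.

open import Defs
open import Data.Nat using (ℕ; zero; suc; _≤_; _<_; _+_; _∸_; z≤n; s≤s)
open import Data.Nat.Properties
  using (≤-trans; ≤-reflexive; ≤-antisym; <-irrefl; +-suc; +-comm; +-monoʳ-≤;
         m≤o∸n⇒m+n≤o; m+n≤o⇒m≤o∸n; m∸[m∸n]≡n)
open import Data.Bool using (true; false; T)
open import Data.Bool.Properties using () renaming (_≟_ to _≟ᵇ_)
open import Data.Fin using (Fin; zero; suc; punchIn; punchOut; _≟_)
open import Data.Fin.Properties using (punchIn-punchOut; suc-injective; any?; all?; ¬∀⟶∃¬)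
open import Data.Fin.Subset
  using (Subset; _∈_; _∉_; ∣_∣; ⁅_⁆; _∪_; ∁; Nonempty; outside; inside)
open import Data.Fin.Subset.Properties
  using (x∈⁅x⁆; x∈⁅y⁆⇒x≡y; x∈p∪q⁻; x∈p∪q⁺; ∣⁅x⁆∣≡1; ∣p∣≤∣x∷p∣; ∣p∣≤n; ∣∁p∣≡n∸∣p∣;
         x∈p⇒∣p-x∣<∣p∣; x∈p∧x≢y⇒x∈p-y; x∉p⇒x∈∁p; _∈?_; ∈⊤)
open import Data.Fin.Permutation using (↔⇒≡)
open import Data.Vec using ([]; _∷_; here; there)
open import Data.List using (List; []; _∷_; length)
open import Data.List.Relation.Unary.All using (All; []; _∷_; zipWith)
open import Data.List.Relation.Unary.All.Properties using (¬Any⇒All¬)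
open import Data.List.Relation.Unary.Any using (here; there)
open import Data.List.Relation.Unary.AllPairs using ([]; _∷_)
open import Data.List.Relation.Unary.Unique.Propositional using (Unique)
open import Data.List.Membership.Propositional using () renaming (_∈_ to _∈ₗ_)
import Data.List.Membership.DecPropositional as DecMembership
open import Data.Product using (∃; ∃₂; _×_; _,_; proj₁; proj₂)
open import Data.Sum using (_⊎_; inj₁; inj₂; [_,_]′; swap) renaming (map to ⊎-map)
open import Data.Empty using (⊥-elim)
open import Function using (_∘_; id)
open import Function.Bundles using (_⇔_; mk⇔; mk↔ₛ′)
open import Relation.Nullary using (¬_; Dec; yes; no)
open import Relation.Nullary.Decidable using (T?; _⊎-dec_; _×-dec_; ¬?; from-yes; _→-dec_)
open import Relation.Binary.PropositionalEquality
  using (_≡_; _≢_; refl; sym; trans; cong; cong₂; subst; ≢-sym; module ≡-Reasoning)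

∣p∪q∣≤∣p∣+∣q∣ : ∀ {n} (p q : Subset n) → ∣ p ∪ q ∣ ≤ ∣ p ∣ + ∣ q ∣
∣p∪q∣≤∣p∣+∣q∣ [] [] = z≤n
∣p∪q∣≤∣p∣+∣q∣ (outside ∷ p) (outside ∷ q) = ∣p∪q∣≤∣p∣+∣q∣ p q
∣p∪q∣≤∣p∣+∣q∣ (outside ∷ p) (inside ∷ q) =
  subst (suc ∣ p ∪ q ∣ ≤_) (sym (+-suc ∣ p ∣ ∣ q ∣)) (s≤s (∣p∪q∣≤∣p∣+∣q∣ p q))
∣p∪q∣≤∣p∣+∣q∣ (inside ∷ p) (x ∷ q) =
  s≤s (≤-trans (∣p∪q∣≤∣p∣+∣q∣ p q) (+-monoʳ-≤ ∣ p ∣ (∣p∣≤∣x∷p∣ x q)))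

distinct⇒length≤∣p∣ : ∀ {n} {p : Subset n} {xs : List (Fin n)} →
  Unique xs → All (_∈ p) xs → length xs ≤ ∣ p ∣
distinct⇒length≤∣p∣ [] [] = z≤n
distinct⇒length≤∣p∣ {xs = x ∷ _} (x≢xs ∷ unique) (x∈p ∷ xs∈p) =
  ≤-trans (s≤s (distinct⇒length≤∣p∣ unique xs∈p-x)) (x∈p⇒∣p-x∣<∣p∣ x∈p)
  where
  xs∈p-x = zipWith (λ (x≢y , y∈p) → x∈p∧x≢y⇒x∈p-y y∈p (≢-sym x≢y)) (x≢xs , xs∈p)

saturated : ∀ {n} {p : Subset n} {xs : List (Fin n)} {x} →
  Unique xs → All (_∈ p) xs → ∣ p ∣ ≤ length xs → x ∈ p → x ∈ₗ xs
saturated {xs = xs} {x} unique xs∈p full x∈p with DecMembership._∈?_ _≟_ x xs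
... | yes x∈xs = x∈xs
... | no x∉xs = ⊥-elim (<-irrefl refl (≤-trans longer full))
  where
  longer = distinct⇒length≤∣p∣ (¬Any⇒All¬ xs x∉xs ∷ unique) (x∈p ∷ xs∈p)

member : ∀ {n} (p : Subset n) → 1 ≤ ∣ p ∣ → Nonempty p
member (inside ∷ p) _ = zero , here
member (outside ∷ p) h = let (x , x∈p) = member p h in suc x , there x∈p

twoMembers : ∀ {n} (p : Subset n) → 2 ≤ ∣ p ∣ → ∃₂ λ x y → x ∈ p × y ∈ p × x ≢ y
twoMembers (inside ∷ p) (s≤s h) =
  let (y , y∈p) = member p h in zero , suc y , here , there y∈p , λ ()
twoMembers (outside ∷ p) h =
  let (x , y , x∈p , y∈p , x≢y) = twoMembers p h
  in suc x , suc y , there x∈p , there y∈p , x≢y ∘ suc-injective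

walkStart : ∀ {n} {G : Graph n} {D x y} → WalkIn G D x y → x ∈ D
walkStart (here x∈D) = x∈D
walkStart (step x∈D _ _) = x∈D

firstStep : ∀ {n} {G : Graph n} {D x y} → WalkIn G D x y → x ≢ y → ∃ λ w → w ∈ D × Adj G x w
firstStep (here _) x≢y = ⊥-elim (x≢y refl)
firstStep (step _ x~w rest) _ = _ , walkStart rest , x~w

module SimpleGraph {n} {G : Graph n} (simple : Simple G) where

  adj-sym : ∀ {x y} → Adj G x y → Adj G y x
  adj-sym {x} {y} = subst T (proj₁ simple x y)

  adj⇒≢ : ∀ {x y} → Adj G x y → x ≢ y
  adj⇒≢ x~x refl = subst T (proj₂ simple _) x~x

-- Closed neighbourhoods and pair domination

Near : ∀ {n} → Graph n → Fin n → Fin n → Set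
Near G p w = w ≡ p ⊎ Adj G p w

PairDominates : ∀ {n} → Graph n → Fin n → Fin n → Fin n → Set
PairDominates G p q w = Near G p w ⊎ Near G q w

pairDominates? : ∀ {n} (G : Graph n) p q w → Dec (PairDominates G p q w)
pairDominates? G p q w = ((w ≟ p) ⊎-dec T? (G p w)) ⊎-dec ((w ≟ q) ⊎-dec T? (G q w))

near-sym : ∀ {n} {G : Graph n} {p q} → Simple G → Near G p q → Near G q p
near-sym simple (inj₁ q≡p) = inj₁ (sym q≡p)
near-sym simple (inj₂ p~q) = inj₂ (SimpleGraph.adj-sym simple p~q)

pair : ∀ {n} → Fin n → Fin n → Subset n
pair p q = ⁅ p ⁆ ∪ ⁅ q ⁆

p∈pair : ∀ {n} (p q : Fin n) → p ∈ pair p q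
p∈pair p q = x∈p∪q⁺ (inj₁ (x∈⁅x⁆ p))

q∈pair : ∀ {n} (p q : Fin n) → q ∈ pair p q
q∈pair p q = x∈p∪q⁺ (inj₂ (x∈⁅x⁆ q))

pair⁻ : ∀ {n} {p q w : Fin n} → w ∈ pair p q → w ≡ p ⊎ w ≡ q
pair⁻ {p = p} {q} = ⊎-map (x∈⁅y⁆⇒x≡y p) (x∈⁅y⁆⇒x≡y q) ∘ x∈p∪q⁻ ⁅ p ⁆ ⁅ q ⁆

∣pair∣≤2 : ∀ {n} (p q : Fin n) → ∣ pair p q ∣ ≤ 2
∣pair∣≤2 p q = subst (∣ pair p q ∣ ≤_) (cong₂ _+_ (∣⁅x⁆∣≡1 p) (∣⁅x⁆∣≡1 q)) (∣p∪q∣≤∣p∣+∣q∣ ⁅ p ⁆ ⁅ q ⁆)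

pairIsCDS : ∀ {n} {G : Graph n} {p q} → Simple G →
  Near G p q → (∀ w → PairDominates G p q w) → IsCDS G (pair p q)
pairIsCDS {G = G} {p} {q} simple p≈q dominated = dominating , connected
  where
  dominating : Dominating G (pair p q)
  dominating w with dominated w
  ... | inj₁ (inj₁ refl) = inj₁ (p∈pair p q)
  ... | inj₁ (inj₂ p~w) = inj₂ (p , p∈pair p q , p~w)
  ... | inj₂ (inj₁ refl) = inj₁ (q∈pair p q)
  ... | inj₂ (inj₂ q~w) = inj₂ (q , q∈pair p q , q~w)
  link : ∀ {x y} → x ∈ pair p q → y ∈ pair p q → Near G x y → WalkIn G (pair p q) x y
  link x∈ y∈ (inj₁ refl) = here x∈
  link x∈ y∈ (inj₂ x~y) = step x∈ x~y (here y∈)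
  connected : InducedConnected G (pair p q)
  connected x y x∈ y∈ with pair⁻ x∈ | pair⁻ y∈
  ... | inj₁ refl | inj₁ refl = here x∈
  ... | inj₂ refl | inj₂ refl = here x∈
  ... | inj₁ refl | inj₂ refl = link x∈ y∈ p≈q
  ... | inj₂ refl | inj₁ refl = link x∈ y∈ (near-sym simple p≈q)

gammaC3⇒noDominatingPair : ∀ {n} {G : Graph n} → Simple G → IsGammaC G 3 →
  ∀ p q → Near G p q → ¬ (∀ w → PairDominates G p q w)
gammaC3⇒noDominatingPair simple (_ , minimal) p q p≈q dominated
  with ≤-trans (minimal (pair p q) (pairIsCDS simple p≈q dominated)) (∣pair∣≤2 p q)
... | s≤s (s≤s ())

coveredPairDominates : ∀ {n} {G : Graph n} {D p q} → Dominating G D →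
  (∀ w → w ∈ D → w ≡ p ⊎ w ≡ q) → ∀ w → PairDominates G p q w
coveredPairDominates dominating covered w with dominating w
... | inj₁ w∈D = ⊎-map inj₁ inj₁ (covered w w∈D)
... | inj₂ (x , x∈D , x~w) = ⊎-map (λ { refl → inj₂ x~w }) (λ { refl → inj₂ x~w }) (covered x x∈D)

smallCDS⇒dominatingPair : ∀ {m} {H : Graph (suc m)} {D} → (∀ i → H i i ≡ false) →
  IsCDS H D → ∣ D ∣ ≤ 2 → ∃₂ λ p q → Near H p q × (∀ w → PairDominates H p q w)
smallCDS⇒dominatingPair {H = H} {D} loopless (dominating , connected) ∣D∣≤2
  with anchor | any? (λ y → (y ∈? D) ×-dec ¬? (y ≟ proj₁ anchor))
  where
  anchor : ∃ λ x → x ∈ D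
  anchor with dominating zero
  ... | inj₁ zero∈D = zero , zero∈D
  ... | inj₂ (x , x∈D , _) = x , x∈D
... | x , x∈D | no alone = x , x , inj₁ refl , coveredPairDominates dominating only-x
  where
  only-x : ∀ w → w ∈ D → w ≡ x ⊎ w ≡ x
  only-x w w∈D with w ≟ x
  ... | yes w≡x = inj₁ w≡x
  ... | no w≢x = ⊥-elim (alone (w , w∈D , w≢x))
... | x , x∈D | yes (y , y∈D , y≢x) = x , y , inj₂ x~y , coveredPairDominates dominating x-or-y
  where
  x-or-y : ∀ w → w ∈ D → w ≡ x ⊎ w ≡ y
  x-or-y w w∈D with saturated ((≢-sym y≢x ∷ []) ∷ [] ∷ []) (x∈D ∷ y∈D ∷ []) ∣D∣≤2 w∈D
  ... | here w≡x = inj₁ w≡x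
  ... | there (here w≡y) = inj₂ w≡y
  x~y : Adj H x y
  x~y with firstStep (connected x y x∈D y∈D) (≢-sym y≢x)
  ... | z , z∈D , x~z with x-or-y z z∈D
  ...   | inj₁ refl = ⊥-elim (subst T (loopless z) x~z)
  ...   | inj₂ refl = x~z

liftNear : ∀ {m} {G : Graph (suc m)} {v p w} →
  Near (removeVertex G v) p w → Near G (punchIn v p) (punchIn v w)
liftNear (inj₁ w≡p) = inj₁ (cong (punchIn _) w≡p)
liftNear (inj₂ p~w) = inj₂ p~w

deletionPair : ∀ {m} {G : Graph (suc (suc m))} → Simple G → ∀ v →
  (∃ λ k → k < 3 × IsGammaC (removeVertex G v) k) →
  ∃₂ λ p q → Near G p q × (∀ w → w ≢ v → PairDominates G p q w)
deletionPair {G = G} simple v (k , s≤s k≤2 , (D , cds , ∣D∣≡k) , _)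
  with smallCDS⇒dominatingPair (proj₂ simple ∘ punchIn v) cds (subst (_≤ 2) (sym ∣D∣≡k) k≤2)
... | p , q , p≈q , dominated = punchIn v p , punchIn v q , liftNear {G = G} p≈q , dominatedInG
  where
  dominatedInG : ∀ w → w ≢ v → PairDominates G (punchIn v p) (punchIn v q) w
  dominatedInG w w≢v = subst (PairDominates G (punchIn v p) (punchIn v q))
    (punchIn-punchOut (≢-sym w≢v))
    (⊎-map (liftNear {G = G}) (liftNear {G = G}) (dominated (punchOut (≢-sym w≢v))))

record PairCritical {n} (G : Graph n) : Set where
  field
    noDominatingPair : ∀ p q → Near G p q → ¬ (∀ w → PairDominates G p q w)
    pairMissing : ∀ v → ∃₂ λ p q →
      Near G p q × ¬ PairDominates G p q v × (∀ w → w ≢ v → PairDominates G p q w)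

vertexCritical⇒pairCritical : ∀ {m} {G : Graph (suc (suc m))} → Simple G → IsGammaC G 3 →
  (∀ v → ∃ λ k → k < 3 × IsGammaC (removeVertex G v) k) → PairCritical G
vertexCritical⇒pairCritical {G = G} simple γc≡3 deletion = record
  { noDominatingPair = noPair ; pairMissing = missing }
  where
  noPair = gammaC3⇒noDominatingPair simple γc≡3
  missing : ∀ v → ∃₂ λ p q →
    Near G p q × ¬ PairDominates G p q v × (∀ w → w ≢ v → PairDominates G p q w)
  missing v with deletionPair simple v (deletion v)
  ... | p , q , p≈q , others = p , q , p≈q , missesV , others
    where
    -- otherwise {p, q} would dominate all of G
    missesV : ¬ PairDominates G p q v
    missesV dominatesV = noPair p q p≈q everywhere
      where
      everywhere : ∀ w → PairDominates G p q w
      everywhere w with w ≟ v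
      ... | yes refl = dominatesV
      ... | no w≢v = others w w≢v

-- Recognising C5

TwinFree : ∀ {m} → Graph m → Set
TwinFree {m} H = ∀ (i j : Fin m) → (∀ k → H i k ≡ H j k) → i ≡ j

C5-twinFree : TwinFree C5
C5-twinFree = from-yes (all? λ i → all? λ j → all? (λ k → C5 i k ≟ᵇ C5 j k) →-dec (i ≟ j))

-- A twin-free graph H occurring in G as an induced subgraph through a surjective map f
-- is isomorphic to G: twin-freeness makes f injective.
spanningCopy⇒iso : ∀ {n m} {G : Graph n} (H : Graph m) → TwinFree H → (f : Fin m → Fin n) →
  (∀ i j → G (f i) (f j) ≡ H i j) → (∀ x → ∃ λ i → f i ≡ x) → Isomorphic G H
spanningCopy⇒iso {n} {m} {G} H twinFree f induced onto =
  mk↔ₛ′ index f index∘f f∘index , λ x y →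
    trans (cong₂ G (sym (f∘index x)) (sym (f∘index y))) (induced (index x) (index y))
  where
  index : Fin n → Fin m
  index x = proj₁ (onto x)
  f∘index : ∀ x → f (index x) ≡ x
  f∘index x = proj₂ (onto x)
  injective : ∀ {i j} → f i ≡ f j → i ≡ j
  injective {i} {j} fi≡fj = twinFree i j λ k → begin
    H i k         ≡⟨ sym (induced i k) ⟩
    G (f i) (f k) ≡⟨ cong (λ z → G z (f k)) fi≡fj ⟩
    G (f j) (f k) ≡⟨ induced j k ⟩
    H j k         ∎
    where open ≡-Reasoning
  index∘f : ∀ i → index (f i) ≡ i
  index∘f i = injective (f∘index (f i))

pattern one = suc zero
pattern two = suc one
pattern three = suc two
pattern four = suc three

record Pentagon {n} (G : Graph n) : Set where
  field
    v₀ v₁ v₂ v₃ v₄ : Fin n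
    v₀~v₁ : Adj G v₀ v₁
    v₁~v₂ : Adj G v₁ v₂
    v₂~v₃ : Adj G v₂ v₃
    v₃~v₄ : Adj G v₃ v₄
    v₄~v₀ : Adj G v₄ v₀
    v₀≁v₂ : ¬ Adj G v₀ v₂
    v₀≁v₃ : ¬ Adj G v₀ v₃
    v₁≁v₃ : ¬ Adj G v₁ v₃
    v₁≁v₄ : ¬ Adj G v₁ v₄
    v₂≁v₄ : ¬ Adj G v₂ v₄

  vertex : Fin 5 → Fin n
  vertex zero  = v₀
  vertex one   = v₁
  vertex two   = v₂
  vertex three = v₃
  vertex four  = v₄

pentagon⇒C5 : ∀ {n} {G : Graph n} → Simple G → (P : Pentagon G) →
  (∀ x → ∃ λ i → Pentagon.vertex P i ≡ x) → Isomorphic G C5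
pentagon⇒C5 {G = G} simple P onto = spanningCopy⇒iso C5 C5-twinFree vertex table onto
  where
  open Pentagon P
  open SimpleGraph simple
  edge : ∀ {x y} → Adj G x y → G x y ≡ true
  edge {x} {y} x~y with G x y
  ... | true = refl
  edge′ : ∀ {x y} → Adj G x y → G y x ≡ true
  edge′ = edge ∘ adj-sym
  non : ∀ {x y} → ¬ Adj G x y → G x y ≡ false
  non {x} {y} x≁y with G x y
  ... | true = ⊥-elim (x≁y _)
  ... | false = refl
  non′ : ∀ {x y} → ¬ Adj G x y → G y x ≡ false
  non′ x≁y = non (x≁y ∘ adj-sym)
  loop : ∀ x → G x x ≡ false
  loop = proj₂ simple
  table : ∀ i j → G (vertex i) (vertex j) ≡ C5 i j
  table zero  zero  = loop v₀
  table zero  one   = edge v₀~v₁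
  table zero  two   = non v₀≁v₂
  table zero  three = non v₀≁v₃
  table zero  four  = edge′ v₄~v₀
  table one   zero  = edge′ v₀~v₁
  table one   one   = loop v₁
  table one   two   = edge v₁~v₂
  table one   three = non v₁≁v₃
  table one   four  = non v₁≁v₄
  table two   zero  = non′ v₀≁v₂
  table two   one   = edge′ v₁~v₂
  table two   two   = loop v₂
  table two   three = edge v₂~v₃
  table two   four  = non v₂≁v₄
  table three zero  = non′ v₀≁v₃
  table three one   = non′ v₁≁v₃
  table three two   = edge′ v₂~v₃
  table three three = loop v₃
  table three four  = edge v₃~v₄
  table four  zero  = edge v₄~v₀
  table four  one   = non′ v₁≁v₄
  table four  two   = non′ v₂≁v₄
  table four  three = edge′ v₃~v₄
  table four  four  = loop v₄

-- Cliques in a pair-critical graph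

module CliqueAnalysis {n} {G : Graph n} (simple : Simple G) (critical : PairCritical G)
                      {K : Subset n} (clique : IsClique G K) where
  open PairCritical critical
  open SimpleGraph simple

  cliqueNear : ∀ {p x} → p ∈ K → x ∈ K → Near G p x
  cliqueNear {p} {x} p∈K x∈K with x ≟ p
  ... | yes x≡p = inj₁ x≡p
  ... | no x≢p = inj₂ (clique p x p∈K x∈K (≢-sym x≢p))

  record OutsideTriple (a b : Fin n) : Set where
    field
      u w t : Fin n
      u~w : Adj G u w
      w~t : Adj G w t
      u~b : Adj G u b
      u≁t : ¬ Near G u t
      b≁t : ¬ Near G b t
      missesA : ¬ PairDominates G u w a
      covers : ∀ x → x ≢ a → PairDominates G u w x

  completeTriple : ∀ {a b} → a ∈ K → b ∈ K → ∀ u w → Near G u w → Adj G u b →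
    ¬ PairDominates G u w a → (∀ x → x ≢ a → PairDominates G u w x) → OutsideTriple a b
  completeTriple {a} {b} a∈K b∈K u w u≈w u~b missesA covers
    with ¬∀⟶∃¬ n _ (pairDominates? G b u) (noDominatingPair b u (inj₂ (adj-sym u~b)))
  ... | t , bu-missesT = record
    { u = u ; w = w ; t = t ; u~w = u~w ; w~t = w~t ; u~b = u~b ; u≁t = u≁t ; b≁t = b≁t
    ; missesA = missesA ; covers = covers }
    where
    b≁t : ¬ Near G b t
    b≁t = bu-missesT ∘ inj₁
    u≁t : ¬ Near G u t
    u≁t = bu-missesT ∘ inj₂
    t≢a : t ≢ a
    t≢a refl = b≁t (cliqueNear b∈K a∈K)
    w≈t : Near G w t
    w≈t = [ ⊥-elim ∘ u≁t , id ]′ (covers t t≢a)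
    -- w = u would put t in N[u]
    u~w : Adj G u w
    u~w = [ (λ w≡u → ⊥-elim (u≁t (subst (λ z → Near G z t) w≡u w≈t))) , id ]′ u≈w
    -- t = w would put t in N[u]
    w~t : Adj G w t
    w~t = [ (λ t≡w → ⊥-elim (u≁t (inj₂ (subst (Adj G u) (sym t≡w) u~w)))) , id ]′ w≈t

  -- A vertex near b ∈ K but not near a ∈ K is outside K, hence adjacent to b.
  outsideNeighbour : ∀ {a b x} → a ∈ K → b ∈ K → Near G x b → ¬ Near G x a → Adj G x b
  outsideNeighbour a∈K b∈K (inj₁ refl) x≁a = ⊥-elim (x≁a (cliqueNear b∈K a∈K))
  outsideNeighbour a∈K b∈K (inj₂ x~b) _ = x~b

  outsideTriple : ∀ {a b} → a ∈ K → b ∈ K → a ≢ b → OutsideTriple a b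
  outsideTriple {a} {b} a∈K b∈K a≢b with pairMissing a
  ... | p , q , p≈q , missesA , covers with covers b (≢-sym a≢b)
  ...   | inj₁ p≈b = completeTriple a∈K b∈K p q p≈q (outsideNeighbour a∈K b∈K p≈b (missesA ∘ inj₁))
                       missesA covers
  ...   | inj₂ q≈b = completeTriple a∈K b∈K q p (near-sym simple p≈q)
                       (outsideNeighbour a∈K b∈K q≈b (missesA ∘ inj₂))
                       (missesA ∘ swap) (λ x → swap ∘ covers x)

  module Outside {a b} (a∈K : a ∈ K) (b∈K : b ∈ K) (triple : OutsideTriple a b) where
    open OutsideTriple triple public

    u∉K : u ∉ K
    u∉K u∈K = missesA (inj₁ (cliqueNear u∈K a∈K))

    w∉K : w ∉ K
    w∉K w∈K = missesA (inj₂ (cliqueNear w∈K a∈K))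

    t∉K : t ∉ K
    t∉K t∈K = b≁t (cliqueNear b∈K t∈K)

    outsideK : All (_∈ ∁ K) (u ∷ w ∷ t ∷ [])
    outsideK = x∉p⇒x∈∁p u∉K ∷ x∉p⇒x∈∁p w∉K ∷ x∉p⇒x∈∁p t∉K ∷ []

    distinct : Unique (u ∷ w ∷ t ∷ [])
    distinct = (adj⇒≢ u~w ∷ u≢t ∷ []) ∷ (w≢t ∷ []) ∷ [] ∷ []
      where
      u≢t : u ≢ t
      u≢t u≡t = u≁t (inj₁ (sym u≡t))
      w≢t : w ≢ t
      w≢t refl = u≁t (inj₂ u~w)

  cliqueBound : ∀ {a b} → a ∈ K → b ∈ K → a ≢ b → ∣ K ∣ ≤ n ∸ 3
  cliqueBound a∈K b∈K a≢b =
    m+n≤o⇒m≤o∸n ∣ K ∣ (subst (_≤ n) (+-comm 3 ∣ K ∣) (m≤o∸n⇒m+n≤o 3 (∣p∣≤n K) three≤n∸∣K∣))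
    where
    open Outside a∈K b∈K (outsideTriple a∈K b∈K a≢b)
    three≤n∸∣K∣ : 3 ≤ n ∸ ∣ K ∣
    three≤n∸∣K∣ = subst (3 ≤_) (∣∁p∣≡n∸∣p∣ K) (distinct⇒length≤∣p∣ distinct outsideK)

  -- When only three vertices lie outside K, they are u, w, t and their adjacencies
  -- to K are forced by property (1).
  module Tight {a b} (a∈K : a ∈ K) (b∈K : b ∈ K) (triple : OutsideTriple a b)
               (fewOutside : ∣ ∁ K ∣ ≤ 3) where
    open Outside a∈K b∈K triple public

    outsideIsTriple : ∀ {x} → x ∉ K → x ∈ₗ u ∷ w ∷ t ∷ []
    outsideIsTriple x∉K = saturated distinct outsideK fewOutside (x∉p⇒x∈∁p x∉K)

    dominatesAll : ∀ {k z} → k ∈ K → PairDominates G k z u → PairDominates G k z w →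
      PairDominates G k z t → ∀ x → PairDominates G k z x
    dominatesAll k∈K dom-u dom-w dom-t x with x ∈? K
    ... | yes x∈K = inj₁ (cliqueNear k∈K x∈K)
    ... | no x∉K with outsideIsTriple x∉K
    ...   | here refl = dom-u
    ...   | there (here refl) = dom-w
    ...   | there (there (here refl)) = dom-t

    -- otherwise {k, w} dominates G
    w-far : ∀ {k} → k ∈ K → ¬ Adj G w k
    w-far {k} k∈K w~k = noDominatingPair k w (inj₂ (adj-sym w~k))
      (dominatesAll k∈K (inj₂ (inj₂ (adj-sym u~w))) (inj₂ (inj₁ refl)) (inj₂ (inj₂ w~t)))

    u-close : ∀ {k} → k ∈ K → k ≢ a → Adj G u k
    u-close k∈K k≢a with covers _ k≢a
    ... | inj₁ (inj₁ refl) = ⊥-elim (u∉K k∈K)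
    ... | inj₁ (inj₂ u~k) = u~k
    ... | inj₂ (inj₁ refl) = ⊥-elim (w∉K k∈K)
    ... | inj₂ (inj₂ w~k) = ⊥-elim (w-far k∈K w~k)

    -- otherwise {k, u} dominates G
    t-far : ∀ {k} → k ∈ K → k ≢ a → ¬ Adj G t k
    t-far {k} k∈K k≢a t~k = noDominatingPair k u (inj₂ (adj-sym (u-close k∈K k≢a)))
      (dominatesAll k∈K (inj₂ (inj₁ refl)) (inj₂ (inj₂ u~w)) (inj₁ (inj₂ (adj-sym t~k))))

  -- With only three vertices outside K, the triples for (a, b) and (b, a) together
  -- show that a b u w t is an induced pentagon spanning G.
  tight⇒C5 : ∀ {a b} → a ∈ K → b ∈ K → a ≢ b → ∣ ∁ K ∣ ≤ 3 → Isomorphic G C5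
  tight⇒C5 {a} {b} a∈K b∈K a≢b fewOutside = pentagon⇒C5 simple pentagon spanning
    where
    open Tight a∈K b∈K (outsideTriple a∈K b∈K a≢b) fewOutside
    module Swapped = Tight b∈K a∈K (outsideTriple b∈K a∈K (≢-sym a≢b)) fewOutside

    -- the triple for (b, a) starts at a neighbour of a outside K, which can only be t
    u′≡t : Swapped.u ≡ t
    u′≡t with outsideIsTriple Swapped.u∉K
    ... | here u′≡u = ⊥-elim (missesA (inj₁ (inj₂ (subst (λ z → Adj G z a) u′≡u u′~a))))
      where u′~a = Swapped.u-close a∈K a≢b
    ... | there (here u′≡w) = ⊥-elim (w-far a∈K (subst (λ z → Adj G z a) u′≡w u′~a))
      where u′~a = Swapped.u-close a∈K a≢b
    ... | there (there (here u′≡t)) = u′≡t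

    t~a : Adj G t a
    t~a = subst (λ z → Adj G z a) u′≡t (Swapped.u-close a∈K a≢b)

    -- t would see every k ∈ K - {a, b} through u′ while missing it as t
    K≡ab : ∀ {k} → k ∈ K → k ≡ a ⊎ k ≡ b
    K≡ab {k} k∈K with k ≟ a | k ≟ b
    ... | yes k≡a | _ = inj₁ k≡a
    ... | no _ | yes k≡b = inj₂ k≡b
    ... | no k≢a | no k≢b =
      ⊥-elim (t-far k∈K k≢a (subst (λ z → Adj G z k) u′≡t (Swapped.u-close k∈K k≢b)))

    pentagon : Pentagon G
    pentagon = record
      { v₀ = a ; v₁ = b ; v₂ = u ; v₃ = w ; v₄ = t
      ; v₀~v₁ = clique a b a∈K b∈K a≢b ; v₁~v₂ = adj-sym u~b ; v₂~v₃ = u~w ; v₃~v₄ = w~t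
      ; v₄~v₀ = t~a
      ; v₀≁v₂ = missesA ∘ inj₁ ∘ inj₂ ∘ adj-sym ; v₀≁v₃ = missesA ∘ inj₂ ∘ inj₂ ∘ adj-sym
      ; v₁≁v₃ = w-far b∈K ∘ adj-sym ; v₁≁v₄ = b≁t ∘ inj₂ ; v₂≁v₄ = u≁t ∘ inj₂ }

    spanning : ∀ x → ∃ λ i → Pentagon.vertex pentagon i ≡ x
    spanning x with x ∈? K
    ... | yes x∈K = [ (λ x≡a → zero , sym x≡a) , (λ x≡b → one , sym x≡b) ]′ (K≡ab x∈K)
    ... | no x∉K with outsideIsTriple x∉K
    ...   | here x≡u = two , sym x≡u
    ...   | there (here x≡w) = three , sym x≡w
    ...   | there (there (here x≡t)) = four , sym x≡t

connected⇒ω≥2 : ∀ {m} {G : Graph (suc (suc m))} {ω} → Simple G → Connected G →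
  IsCliqueNumber G ω → 2 ≤ ω
connected⇒ω≥2 {G = G} simple connected (_ , maximum)
  with firstStep (connected zero one ∈⊤ ∈⊤) (λ ())
... | x , _ , zero~x = ≤-trans (distinct⇒length≤∣p∣ ((adj⇒≢ zero~x ∷ []) ∷ [] ∷ [])
                                  (p∈pair zero x ∷ q∈pair zero x ∷ []))
                                (maximum (pair zero x) edgeClique)
  where
  open SimpleGraph simple
  edgeClique : IsClique G (pair zero x)
  edgeClique i j i∈ j∈ i≢j with pair⁻ {p = zero} {x} i∈ | pair⁻ {p = zero} {x} j∈
  ... | inj₁ refl | inj₁ refl = ⊥-elim (i≢j refl)
  ... | inj₁ refl | inj₂ refl = zero~x
  ... | inj₂ refl | inj₁ refl = adj-sym zero~x
  ... | inj₂ refl | inj₂ refl = ⊥-elim (i≢j refl)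

corollary3p8 : ∀ (n : ℕ) (G : Graph n) (ω : ℕ) →
    Simple G → MaximalVertexCritical 3 G → IsCliqueNumber G ω →
    (ω ≤ n ∸ 3) × ((ω ≡ n ∸ 3) ⇔ Isomorphic G C5)
corollary3p8 zero _ _ _ (_ , (() , _) , _) _
corollary3p8 (suc zero) _ _ _ (_ , (s≤s () , _) , _) _
corollary3p8 n@(suc (suc _)) G ω simple (_ , (3≤n , connected , _) , γc≡3 , deletion)
             cliqueNumber@((K , K-clique , ∣K∣≡ω) , _)
  with connected⇒ω≥2 simple connected cliqueNumber
... | ω≥2 with twoMembers K (subst (2 ≤_) (sym ∣K∣≡ω) ω≥2)
... | a , b , a∈K , b∈K , a≢b = ω≤n∸3 , mk⇔ (tight⇒C5 a∈K b∈K a≢b ∘ fewOutside) iso⇒ω≡n∸3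
  where
  open CliqueAnalysis simple (vertexCritical⇒pairCritical simple γc≡3 deletion) K-clique
  ω≤n∸3 : ω ≤ n ∸ 3
  ω≤n∸3 = subst (_≤ n ∸ 3) ∣K∣≡ω (cliqueBound a∈K b∈K a≢b)
  fewOutside : ω ≡ n ∸ 3 → ∣ ∁ K ∣ ≤ 3
  fewOutside ω≡n∸3 = ≤-reflexive (begin
    ∣ ∁ K ∣     ≡⟨ ∣∁p∣≡n∸∣p∣ K ⟩
    n ∸ ∣ K ∣   ≡⟨ cong (n ∸_) (trans ∣K∣≡ω ω≡n∸3) ⟩
    n ∸ (n ∸ 3) ≡⟨ m∸[m∸n]≡n 3≤n ⟩
    3           ∎)
    where open ≡-Reasoning
  -- an isomorphism with C5 forces n = 5, and then 2 ≤ ω ≤ 5 - 3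
  iso⇒ω≡n∸3 : Isomorphic G C5 → ω ≡ n ∸ 3
  iso⇒ω≡n∸3 (f , _) = ≤-antisym ω≤n∸3 (subst (λ k → k ∸ 3 ≤ ω) (sym (↔⇒≡ f)) ω≥2)
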